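{- Let $l$ be an odd prime, $n\geq 2$, $k$ a number field, and let $G=C(l^n)\rtimes_\mu C(l)=\langle\sigma,\tau:\ \sigma^l=\tau^{l^n}=1,\ \sigma\tau\sigma^{ -1}=\tau^{l^{n-1}+1}\rangle$, where $\tau$ generates $C(l^n)$ and $\mu(g_1)(h)=g_1hg_1^{ -1}$ for $g_1\in C(l)=\langle\sigma\rangle$, $h\in C(l^n)$. Let $0<c<n$ be an integer. Then $G_{k,\mu,\tau^{l^c}}^{l^c}\subseteq G_{k,\mu,\tau}$; explicitly: for every $g\in\mathrm{Gal}(k(\zeta_{l^n})/k)$ whose restriction to $k(\zeta_{l^{n-c}})$ lies in $G_{k,\mu,\tau^{l^c}}$, one has $g^{l^c}\in G_{k,\mu,\tau}$.
   Context: For $h\in C(l^n)$ of order $o(h)$, let $\zeta_{o(h)}$ be a primitive $o(h)$-th root of unity (chosen compatibly, $\zeta_{l^{n-c}}=\zeta_{l^n}^{l^c}$) and define $\nu_{k,h}:\mathrm{Gal}(k(\zeta_{o(h)})/k)\to(\mathbb Z/o(h)\mathbb Z)^*$ by $g(\zeta_{o(h)})=\zeta_{o(h)}^{\nu_{k,h}(g)}$. Define \[G_{k,\mu,h}=\{g\in\mathrm{Gal}(k(\zeta_{o(h)})/k):\ \exists g_1\in C(l)\text{ with }\mu(g_1)(h)=h^{\nu_{k,h}(g)}\}.\] Note $o(\tau)=l^n$ and $o(\tau^{l^c})=l^{n-c}$. -}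

module Defs where

open import Data.Nat using (ℕ; _+_; _*_; _^_; _∸_; _<_)
open import Data.Integer as ℤ using (ℤ; +_)
open import Data.Integer.Divisibility as ℤD using ()
open import Data.Product using (Σ; _×_)

-- Congruence modulo m (in ℤ, so no NonZero side conditions):
-- a ≡ b (mod m)  iff  m ∣ (a - b).
EqMod : ℕ → ℕ → ℕ → Set
EqMod m a b = (+ m) ℤD.∣ ((+ a) ℤ.- (+ b))

-- Elements of C(l^n) = ⟨τ⟩ are represented by exponents a (standing for τ^a);
-- two exponents give the same element iff they agree modulo l^n.
SameInC : (l n : ℕ) → ℕ → ℕ → Set
SameInC l n a b = EqMod (l ^ n) a b

-- μ(σ^i)(τ^a) = σ^i τ^a σ^{-i} = τ^{a (l^{n-1}+1)^i}, from σ τ σ⁻¹ = τ^{l^{n-1}+1}.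
-- Returns the exponent of the image.
μ : (l n : ℕ) → (i : ℕ) → (a : ℕ) → ℕ
μ l n i a = a * ((l ^ (n ∸ 1) + 1) ^ i)

-- For h = τ^a and g with ν_{k,h}(g) represented by u:
-- g ∈ G_{k,μ,h}  iff  ∃ g₁ = σ^i ∈ C(l) (i < l) with μ(g₁)(h) = h^u.
InG : (l n : ℕ) → (a : ℕ) → (u : ℕ) → Set
InG l n a u = Σ ℕ (λ i → i < l × SameInC l n (μ l n i a) (a * u))

{-# OPTIONS --safe #-}
-- Conjugation by σ^i multiplies exponents by (l^{n-1}+1)^i ≡ 1 (mod l^{n-1}).
-- So if τ^{l^c} is sent to τ^{l^c u}, cancelling l^c gives u ≡ 1 (mod l^{n-c}),
-- and raising to the l-th power gains one factor of l each time:
-- u^{l^c} ≡ 1 (mod l^n), which puts u^{l^c} in G_{k,μ,τ} with the witness σ^0.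
module Submission where

open import Defs
open import Data.Nat using (ℕ; _^_; _≤_; _<_)
open import Data.Nat.Primality using (Prime)
open import Data.Nat.Coprimality using (Coprime)
open import Relation.Binary.PropositionalEquality using (_≢_)

import Data.Nat as ℕ
import Data.Nat.Properties as ℕ
import Data.Nat.Divisibility as ℕ
open import Data.Nat.Primality using (prime⇒nonZero)
open import Data.Integer
  using (ℤ; +_; _+_; _-_; _*_; -_; 1ℤ; 0ℤ) renaming (_^_ to _^ℤ_)
import Data.Integer.Properties as ℤ
open import Data.Integer.Divisibility.Signed
open import Data.Integer.Tactic.RingSolver using (solve-∀)
open import Data.Product using (_,_)
open import Relation.Binary.PropositionalEquality
  using (_≡_; refl; sym; trans; cong; cong₂; subst; subst₂; module ≡-Reasoning)

pos-^ : ∀ m n → + (m ^ n) ≡ (+ m) ^ℤ n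
pos-^ m ℕ.zero    = refl
pos-^ m (ℕ.suc n) = trans (ℤ.pos-* m (m ^ n)) (cong (+ m *_) (pos-^ m n))

∣x-y⇒∣x^i-y^i : ∀ {d} x y i → d ∣ x - y → d ∣ x ^ℤ i - y ^ℤ i
∣x-y⇒∣x^i-y^i x y ℕ.zero    _   = divides 0ℤ refl
∣x-y⇒∣x^i-y^i x y (ℕ.suc i) d∣x-y =
  subst (_ ∣_) (factor x y (x ^ℤ i) (y ^ℤ i))
    (∣m∣n⇒∣m+n (∣n⇒∣m*n x (∣x-y⇒∣x^i-y^i x y i d∣x-y)) (∣m⇒∣m*n (y ^ℤ i) d∣x-y))
  where
  factor : ∀ x y xⁱ yⁱ → x * (xⁱ - yⁱ) + (x - y) * yⁱ ≡ x * xⁱ - y * yⁱ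
  factor = solve-∀

geometricSum : ℤ → ℕ → ℤ
geometricSum u ℕ.zero    = 0ℤ
geometricSum u (ℕ.suc j) = u ^ℤ j + geometricSum u j

[u-1]*geometricSum≡u^j-1 : ∀ u j → (u - 1ℤ) * geometricSum u j ≡ u ^ℤ j - 1ℤ
[u-1]*geometricSum≡u^j-1 u ℕ.zero    = ℤ.*-zeroʳ (u - 1ℤ)
[u-1]*geometricSum≡u^j-1 u (ℕ.suc j) = begin
  (u - 1ℤ) * (u ^ℤ j + geometricSum u j)
    ≡⟨ expand u (u ^ℤ j) (geometricSum u j) ⟩
  u * u ^ℤ j - u ^ℤ j + (u - 1ℤ) * geometricSum u j
    ≡⟨ cong (λ s → u * u ^ℤ j - u ^ℤ j + s) ([u-1]*geometricSum≡u^j-1 u j) ⟩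
  u * u ^ℤ j - u ^ℤ j + (u ^ℤ j - 1ℤ)
    ≡⟨ telescope (u * u ^ℤ j) (u ^ℤ j) ⟩
  u * u ^ℤ j - 1ℤ
    ∎
  where
  open ≡-Reasoning
  expand : ∀ u x s → (u - 1ℤ) * (x + s) ≡ u * x - x + (u - 1ℤ) * s
  expand = solve-∀
  telescope : ∀ y x → y - x + (x - 1ℤ) ≡ y - 1ℤ
  telescope = solve-∀

∣u-1⇒∣geometricSum-j : ∀ {d} u j → d ∣ u - 1ℤ → d ∣ geometricSum u j - + j
∣u-1⇒∣geometricSum-j u ℕ.zero    _     = divides 0ℤ refl
∣u-1⇒∣geometricSum-j u (ℕ.suc j) d∣u-1 =
  subst (_ ∣_) (regroup (u ^ℤ j) (geometricSum u j) (+ j))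
    (∣m∣n⇒∣m+n uʲ≡1 (∣u-1⇒∣geometricSum-j u j d∣u-1))
  where
  uʲ≡1 : _ ∣ u ^ℤ j - 1ℤ
  uʲ≡1 = subst (λ z → _ ∣ u ^ℤ j - z) (ℤ.^-zeroˡ j) (∣x-y⇒∣x^i-y^i u 1ℤ j d∣u-1)
  regroup : ∀ x s k → x - 1ℤ + (s - k) ≡ x + s - (1ℤ + k)
  regroup = solve-∀

*-cong-∣ : ∀ {a b c d} → a ∣ b → c ∣ d → a * c ∣ b * d
*-cong-∣ {a} {c = c} (divides q refl) (divides r refl) =
  divides (q * r) (interchange q a r c)
  where
  interchange : ∀ q a r c → q * a * (r * c) ≡ q * r * (a * c)
  interchange = solve-∀

-- u^p - 1 = (u - 1)(1 + u + ⋯ + u^{p-1}), and the second factor is ≡ p ≡ 0 (mod p).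
∣u-1⇒∣u^p-1 : ∀ {m} u p → m ∣ u - 1ℤ → + p ∣ m → m * + p ∣ u ^ℤ p - 1ℤ
∣u-1⇒∣u^p-1 u p m∣u-1 p∣m =
  subst (_ ∣_) ([u-1]*geometricSum≡u^j-1 u p) (*-cong-∣ m∣u-1 p∣geometricSum)
  where
  p∣geometricSum : + p ∣ geometricSum u p
  p∣geometricSum = subst (_ ∣_) (cancel (geometricSum u p) (+ p))
    (∣m∣n⇒∣m+n (∣u-1⇒∣geometricSum-j u p (∣-trans p∣m m∣u-1)) ∣-refl)
    where
    cancel : ∀ s p → s - p + p ≡ s
    cancel = solve-∀

∣u-1⇒∣u^[l^k]-1 : ∀ {m} l u k → + l ∣ m → m ∣ u - 1ℤ → m * + (l ^ k) ∣ u ^ℤ (l ^ k) - 1ℤ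
∣u-1⇒∣u^[l^k]-1 {m} l u ℕ.zero    _   m∣u-1 =
  subst₂ _∣_ (sym (ℤ.*-identityʳ m)) (cong (_- 1ℤ) (sym (ℤ.^-identityʳ u))) m∣u-1
∣u-1⇒∣u^[l^k]-1 {m} l u (ℕ.suc k) l∣m m∣u-1 =
  subst₂ _∣_ modulus power
    (∣u-1⇒∣u^p-1 (u ^ℤ (l ^ k)) l (∣u-1⇒∣u^[l^k]-1 l u k l∣m m∣u-1) (∣m⇒∣m*n (+ (l ^ k)) l∣m))
  where
  modulus : m * + (l ^ k) * + l ≡ m * + (l ^ ℕ.suc k)
  modulus = trans (ℤ.*-assoc m (+ (l ^ k)) (+ l))
    (cong (m *_) (trans (ℤ.*-comm (+ (l ^ k)) (+ l)) (sym (ℤ.pos-* l (l ^ k)))))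
  power : (u ^ℤ (l ^ k)) ^ℤ l - 1ℤ ≡ u ^ℤ (l ^ ℕ.suc k) - 1ℤ
  power = cong (_- 1ℤ) (trans (ℤ.^-*-assoc u (l ^ k) l) (cong (u ^ℤ_) (ℕ.*-comm (l ^ k) l)))

^-monoʳ-∣ : ∀ l {m n} → m ≤ n → l ^ m ℕ.∣ l ^ n
^-monoʳ-∣ l {m} {n} m≤n = ℕ.divides (l ^ (n ℕ.∸ m))
  (sym (trans (sym (ℕ.^-distribˡ-+-* l (n ℕ.∸ m) m)) (cong (l ^_) (ℕ.m∸n+n≡m m≤n))))

∣[1+m]^i-1 : ∀ m i → + m ∣ + ((m ℕ.+ 1) ^ i) - 1ℤ
∣[1+m]^i-1 m i = subst₂ (λ x y → + m ∣ x - y) (sym (pos-^ (m ℕ.+ 1) i)) (ℤ.^-zeroˡ i)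
  (∣x-y⇒∣x^i-y^i (+ (m ℕ.+ 1)) 1ℤ i m∣[1+m]-1)
  where
  drop1 : ∀ x → x + 1ℤ - 1ℤ ≡ 1ℤ * x
  drop1 = solve-∀
  m∣[1+m]-1 : + m ∣ + (m ℕ.+ 1) - 1ℤ
  m∣[1+m]-1 = divides 1ℤ (trans (cong (_- 1ℤ) (ℤ.pos-+ m 1)) (drop1 (+ m)))

EqMod-cancelˡ : ∀ k {m a b} .{{_ : ℕ.NonZero k}} →
                EqMod (k ℕ.* m) (k ℕ.* a) (k ℕ.* b) → + m ∣ + a - + b
EqMod-cancelˡ k {m} {a} {b} km∣ka-kb = *-cancelˡ-∣ (+ k)
  (subst₂ _∣_ (ℤ.pos-* k m)
    (trans (cong₂ _-_ (ℤ.pos-* k a) (ℤ.pos-* k b)) (factor (+ k) (+ a) (+ b)))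
    (∣ᵤ⇒∣ km∣ka-kb))
  where
  factor : ∀ k a b → k * a - k * b ≡ k * (a - b)
  factor = solve-∀

InG⇒l^[n-c]∣u-1 : ∀ l n c u .{{_ : ℕ.NonZero l}} → c ≤ n → 0 < c →
                  InG l n (l ^ c) u → + (l ^ (n ℕ.∸ c)) ∣ + u - 1ℤ
InG⇒l^[n-c]∣u-1 l n c u c≤n 0<c (i , _ , sameInC) =
  subst (_ ∣_) (regroup (+ twistⁱ) (+ u))
    (∣m∣n⇒∣m-n (∣-trans l^[n-c]∣l^[n-1] twistⁱ≡1) twistⁱ≡u)
  where
  instance
    l^c≢0 : ℕ.NonZero (l ^ c)
    l^c≢0 = ℕ.m^n≢0 l c
  twistⁱ : ℕ
  twistⁱ = (l ^ (n ℕ.∸ 1) ℕ.+ 1) ^ i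
  l^n≡l^c*l^[n-c] : l ^ n ≡ l ^ c ℕ.* l ^ (n ℕ.∸ c)
  l^n≡l^c*l^[n-c] = trans (cong (l ^_) (sym (ℕ.m+[n∸m]≡n c≤n))) (ℕ.^-distribˡ-+-* l c (n ℕ.∸ c))
  twistⁱ≡u : + (l ^ (n ℕ.∸ c)) ∣ + twistⁱ - + u
  twistⁱ≡u = EqMod-cancelˡ (l ^ c)
    (subst (λ m → EqMod m (l ^ c ℕ.* twistⁱ) (l ^ c ℕ.* u)) l^n≡l^c*l^[n-c] sameInC)
  twistⁱ≡1 : + (l ^ (n ℕ.∸ 1)) ∣ + twistⁱ - 1ℤ
  twistⁱ≡1 = ∣[1+m]^i-1 (l ^ (n ℕ.∸ 1)) i
  l^[n-c]∣l^[n-1] : + (l ^ (n ℕ.∸ c)) ∣ + (l ^ (n ℕ.∸ 1))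
  l^[n-c]∣l^[n-1] = ∣ᵤ⇒∣ (^-monoʳ-∣ l (ℕ.∸-monoʳ-≤ n 0<c))
  regroup : ∀ x u → x - 1ℤ - (x - u) ≡ u - 1ℤ
  regroup = solve-∀

mainTheorem6 : (l n c : ℕ) → Prime l → l ≢ 2 → 2 ≤ n → 0 < c → c < n →
    (u : ℕ) → Coprime u l →
    InG l n (l ^ c) u →
    InG l n 1 (u ^ (l ^ c))
mainTheorem6 l n c l-prime _ _ 0<c c<n u _ inG =
  0 , ℕ.>-nonZero⁻¹ l , ∣⇒∣ᵤ (subst₂ _∣_ l^[n-c]*l^c≡l^n flip (∣m⇒∣-m u^[l^c]≡1))
  where
  instance
    l≢0 : ℕ.NonZero l
    l≢0 = prime⇒nonZero l-prime
  c≤n : c ≤ n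
  c≤n = ℕ.<⇒≤ c<n
  l∣l^[n-c] : + l ∣ + (l ^ (n ℕ.∸ c))
  l∣l^[n-c] = ∣ᵤ⇒∣
    (subst (ℕ._∣ l ^ (n ℕ.∸ c)) (ℕ.^-identityʳ l) (^-monoʳ-∣ l (ℕ.m<n⇒0<n∸m c<n)))
  u^[l^c]≡1 : + (l ^ (n ℕ.∸ c)) * + (l ^ c) ∣ (+ u) ^ℤ (l ^ c) - 1ℤ
  u^[l^c]≡1 = ∣u-1⇒∣u^[l^k]-1 l (+ u) c l∣l^[n-c] (InG⇒l^[n-c]∣u-1 l n c u c≤n 0<c inG)
  l^[n-c]*l^c≡l^n : + (l ^ (n ℕ.∸ c)) * + (l ^ c) ≡ + (l ^ n)
  l^[n-c]*l^c≡l^n = trans (sym (ℤ.pos-* (l ^ (n ℕ.∸ c)) (l ^ c)))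
    (cong +_ (trans (sym (ℕ.^-distribˡ-+-* l (n ℕ.∸ c) c)) (cong (l ^_) (ℕ.m∸n+n≡m c≤n))))
  flip : - ((+ u) ^ℤ (l ^ c) - 1ℤ) ≡ 1ℤ - + (1 ℕ.* u ^ (l ^ c))
  flip = trans (negate ((+ u) ^ℤ (l ^ c)))
    (cong (λ x → 1ℤ - x)
      (trans (sym (pos-^ u (l ^ c))) (cong +_ (sym (ℕ.*-identityˡ (u ^ (l ^ c)))))))
    where
    negate : ∀ x → - (x - 1ℤ) ≡ 1ℤ - x
    negate = solve-∀
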